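{- For every fixed integer $k \ge 1$, there are only finitely many (up to isomorphism) $k$-vertex-critical $(P_5, K_{1,4}+P_1)$-free graphs.
   Context: All graphs are finite, simple and undirected. $P_t$ denotes the path on $t$ vertices, $K_{r,s}$ the complete bipartite graph with parts of sizes $r$ and $s$, and $G+H$ the disjoint union of graphs $G$ and $H$ (so $K_{1,4}+P_1$ is the disjoint union of the star $K_{1,4}$ and an isolated vertex). A graph is $(H_1,H_2)$-free if it contains no induced subgraph isomorphic to $H_1$ or to $H_2$. A graph $G$ is $k$-vertex-critical if $\chi(G)=k$ and $\chi(G-v)<k$ for every vertex $v\in V(G)$, where $\chi$ is the chromatic number. -}

module Defs where

open import Data.Nat using (ℕ; zero; suc; _<_; _≡ᵇ_; _≤ᵇ_)
open import Data.Fin using (Fin; toℕ; punchIn)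
open import Data.Bool using (Bool; true; false; _∧_; _∨_)
open import Data.Bool.Properties using (∨-comm)
open import Data.Product using (Σ; _×_; _,_)
open import Data.List using (List)
open import Data.List.Relation.Unary.Any using (Any)
open import Relation.Binary.PropositionalEquality using (_≡_; _≢_; refl)
open import Relation.Nullary using (¬_)
open import Function.Definitions using (Injective)

record Graph (n : ℕ) : Set where
  field
    adj   : Fin n → Fin n → Bool
    irrefl : ∀ i → adj i i ≡ false
    sym   : ∀ i j → adj i j ≡ adj j i
open Graph public

Colouring : ∀ {n} → ℕ → Graph n → Set
Colouring {n} k G =
  Σ (Fin n → Fin k) λ c → ∀ i j → adj G i j ≡ true → c i ≢ c j

Colourable : ∀ {n} → ℕ → Graph n → Set
Colourable k G = Colouring k G

ChromaticNumber : ∀ {n} → Graph n → ℕ → Set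
ChromaticNumber G k = Colourable k G × (∀ j → j < k → ¬ Colourable j G)

deleteVertex : ∀ {m} → Graph (suc m) → Fin (suc m) → Graph m
deleteVertex G v = record
  { adj = λ i j → adj G (punchIn v i) (punchIn v j)
  ; irrefl = λ i → irrefl G (punchIn v i)
  ; sym = λ i j → sym G (punchIn v i) (punchIn v j)
  }

ChromaticLessThan : ∀ {n} → Graph n → ℕ → Set
ChromaticLessThan H k = Σ ℕ λ j → j < k × ChromaticNumber H j

VertexCritical : ℕ → ∀ {n} → Graph n → Set
VertexCritical k {zero} G = ChromaticNumber G k
VertexCritical k {suc m} G =
  ChromaticNumber G k × (∀ v → ChromaticLessThan (deleteVertex G v) k)

InducedSubgraph : ∀ {m n} → Graph m → Graph n → Set
InducedSubgraph {m} {n} H G =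
  Σ (Fin m → Fin n) λ f →
    Injective _≡_ _≡_ f × (∀ i j → adj H i j ≡ adj G (f i) (f j))

Isomorphic : ∀ {m n} → Graph m → Graph n → Set
Isomorphic {m} {n} G H =
  Σ (Fin m → Fin n) λ f → Σ (Fin n → Fin m) λ g →
    (∀ x → g (f x) ≡ x) × (∀ y → f (g y) ≡ y) ×
    (∀ i j → adj G i j ≡ adj H (f i) (f j))

P5 : Graph 5
P5 = record
  { adj = a
  ; irrefl = λ { Fin.zero → refl ; (Fin.suc Fin.zero) → refl
               ; (Fin.suc (Fin.suc Fin.zero)) → refl
               ; (Fin.suc (Fin.suc (Fin.suc Fin.zero))) → refl
               ; (Fin.suc (Fin.suc (Fin.suc (Fin.suc Fin.zero)))) → refl }
  ; sym = λ i j → ∨-comm (suc (toℕ i) ≡ᵇ toℕ j) (suc (toℕ j) ≡ᵇ toℕ i)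
  }
  where
  a : Fin 5 → Fin 5 → Bool
  a i j = (suc (toℕ i) ≡ᵇ toℕ j) ∨ (suc (toℕ j) ≡ᵇ toℕ i)

-- K_{1,4} + P_1: vertex 0 is the centre, 1..4 the leaves, 5 isolated.
K14+P1 : Graph 6
K14+P1 = record
  { adj = a
  ; irrefl = λ { Fin.zero → refl ; (Fin.suc Fin.zero) → refl
               ; (Fin.suc (Fin.suc Fin.zero)) → refl
               ; (Fin.suc (Fin.suc (Fin.suc Fin.zero))) → refl
               ; (Fin.suc (Fin.suc (Fin.suc (Fin.suc Fin.zero)))) → refl
               ; (Fin.suc (Fin.suc (Fin.suc (Fin.suc (Fin.suc Fin.zero))))) → refl }
  ; sym = λ i j → ∨-comm (e i j) (e j i)
  }
  where
  e : Fin 6 → Fin 6 → Bool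
  e i j = (toℕ i ≡ᵇ 0) ∧ ((1 ≤ᵇ toℕ j) ∧ (toℕ j ≤ᵇ 4))
  a : Fin 6 → Fin 6 → Bool
  a i j = e i j ∨ e j i

Free₂ : ∀ {a b n} → Graph a → Graph b → Graph n → Set
Free₂ H₁ H₂ G = ¬ InducedSubgraph H₁ G × ¬ InducedSubgraph H₂ G

{-# OPTIONS --safe #-}
module Submission where

-- Let G be k-vertex-critical and (P5, K1,4+P1)-free, with a proper k-colouring; it suffices to
-- bound each colour class J. Suppose |J| ≥ 7 and call a vertex big if it has at least four
-- neighbours in J. By K1,4+P1-freeness, for non-adjacent c and u the neighbours of c that u misses
-- meet every independent set in at most three vertices. Hence big vertices are complete to J and
-- to all non-big vertices, and in the subgraph induced by L = J ∪ {non-big vertices} all degrees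
-- are at most Δ = 3 + 15k. A shortest path leaving the radius-3 ball around x ∈ J in G[L] would be
-- an induced P5, so no vertex of L outside the ball has a neighbour in it; if |J| > (Δ + 1)³ some
-- b ∈ J lies outside. This yields a partition (A, B, C) with x ∈ A, b ∈ B, no edges between A and
-- B, and C complete to A ∪ B, which a vertex-critical graph cannot have: colourings of G − x and
-- G − b combine into a colouring of G with fewer than k colours. So G has at most
-- k (6 + (Δ + 1)³) vertices, and there are only finitely many graphs of bounded order.

open import Defs
open import Level using (Level; 0ℓ; _⊔_)
open import Algebra.Properties.CommutativeSemigroup using (interchange)
open import Data.Bool using (Bool; true; false; not; _∧_)
open import Data.Bool.Properties as Bool using (¬-not; not-¬; ∧-comm; ∧-idem)
open import Data.Empty using (⊥; ⊥-elim)
open import Data.Fin using (Fin; zero; suc; punchIn; punchOut; inject₁; fromℕ)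
open import Data.Fin.Properties
  using (_≟_; suc-injective; ¬Fin0; 0≢1+n; any?; all?; ¬∀⟶∃¬; punchIn-punchOut; punchOut-injective)
open import Data.List using (List; []; _∷_; map; concatMap; upTo; cartesianProductWith)
open import Data.List.Membership.Propositional using (lose) renaming (_∈_ to _∈ᴸ_)
open import Data.List.Membership.Propositional.Properties
  using (∈-map⁺; ∈-cartesianProductWith⁺; ∈-upTo⁺)
open import Data.List.Relation.Unary.Any using (Any; here; there)
open import Data.List.Relation.Unary.Any.Properties using (map⁺; concatMap⁺)
open import Data.Nat using (ℕ; zero; suc; _+_; _*_; _^_; _≤_; _<_; z≤n; s≤s; s≤s⁻¹; _≤?_)
open import Data.Nat.Properties
  using ( ≤-refl; ≤-reflexive; ≤-trans; ≤-antisym; ≤-total; ≤-<-trans; <-≤-trans; <-irrefl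
        ; ≰⇒>; ≮⇒≥; +-mono-≤; +-monoˡ-≤; +-cancelˡ-≤; +-cancelˡ-<; +-identityʳ; m≤m+n; m≤n+m
        ; *-comm; *-monoˡ-≤; +-commutativeSemigroup; module ≤-Reasoning )
open import Data.Product using (Σ; ∃; _×_; _,_; proj₁; proj₂)
open import Data.Sum using (_⊎_; inj₁; inj₂; [_,_]; swap)
open import Data.Vec using (Vec; []; _∷_; lookup; tabulate)
open import Data.Vec.Properties using (lookup∘tabulate)
open import Function using (_∘_; id)
open import Function.Definitions using (Injective)
open import Relation.Nullary
  using (¬_; Dec; yes; no; does; contradiction; ¬?; _×-dec_; _⊎-dec_; _→-dec_)
open import Relation.Nullary.Decidable using (toWitness; decidable-stable)
open import Relation.Unary
  using (Pred; Decidable; _∈_; _∉_; _⊆_; _∪_; _∩_; _∖_; ∁; ｛_｝; U; Empty; Satisfiable)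
open import Relation.Unary.Properties using (_∪?_; _∩?_; ∁?; U?)
open import Relation.Binary.PropositionalEquality
  using (_≡_; _≢_; refl; trans; cong; cong₂; subst; subst₂; module ≡-Reasoning)
  renaming (sym to ≡-sym)

private
  variable
    ℓ ℓ₁ ℓ₂ ℓ₃ : Level
    X Y Z : Set ℓ
    m n j k : ℕ

-- Counting decidable subsets of Fin n

_∖?_ : {P : Pred X ℓ₁} {Q : Pred X ℓ₂} → Decidable P → Decidable Q → Decidable (P ∖ Q)
P? ∖? Q? = P? ∩? ∁? Q?

｛_｝? : (y : Fin n) → Decidable ｛ y ｝
｛ y ｝? = y ≟_

indicator : Dec X → ℕ
indicator (yes _) = 1
indicator (no  _) = 0

count : ∀ {n} {P : Pred (Fin n) ℓ} → Decidable P → ℕ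
count {n = zero}  P? = 0
count {n = suc n} P? = indicator (P? zero) + count (P? ∘ suc)

indicator-mono : (X → Y) → (x? : Dec X) (y? : Dec Y) → indicator x? ≤ indicator y?
indicator-mono f (yes a) (no ¬b) = contradiction (f a) ¬b
indicator-mono f (yes _) (yes _) = ≤-refl
indicator-mono f (no  _) _       = z≤n

indicator-cover : (X → Y ⊎ Z) → (x? : Dec X) (y? : Dec Y) (z? : Dec Z) →
                  indicator x? ≤ indicator y? + indicator z?
indicator-cover f (yes a) (no ¬b) (no ¬c) = contradiction (f a) [ ¬b , ¬c ]
indicator-cover f (yes _) (yes _) _       = s≤s z≤n
indicator-cover f (yes _) (no  _) (yes _) = s≤s z≤n
indicator-cover f (no  _) _       _       = z≤n

indicator-disjoint : (X → Y → ⊥) → (x? : Dec X) (y? : Dec Y) →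
                     indicator (x? ⊎-dec y?) ≡ indicator x? + indicator y?
indicator-disjoint f (yes a) (yes b) = ⊥-elim (f a b)
indicator-disjoint f (yes _) (no  _) = refl
indicator-disjoint f (no  _) (yes _) = refl
indicator-disjoint f (no  _) (no  _) = refl

count-mono : ∀ {n} {P : Pred (Fin n) ℓ₁} {Q : Pred (Fin n) ℓ₂} (P? : Decidable P) (Q? : Decidable Q) →
             P ⊆ Q → count P? ≤ count Q?
count-mono {n = zero}  P? Q? P⊆Q = z≤n
count-mono {n = suc n} P? Q? P⊆Q =
  +-mono-≤ (indicator-mono P⊆Q (P? zero) (Q? zero)) (count-mono (P? ∘ suc) (Q? ∘ suc) P⊆Q)

count-cong : ∀ {n} {P : Pred (Fin n) ℓ₁} {Q : Pred (Fin n) ℓ₂} (P? : Decidable P) (Q? : Decidable Q) →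
             P ⊆ Q → Q ⊆ P → count P? ≡ count Q?
count-cong P? Q? P⊆Q Q⊆P = ≤-antisym (count-mono P? Q? P⊆Q) (count-mono Q? P? Q⊆P)

count-cover : ∀ {n} {P : Pred (Fin n) ℓ₁} {Q : Pred (Fin n) ℓ₂} {R : Pred (Fin n) ℓ₃}
              (P? : Decidable P) (Q? : Decidable Q) (R? : Decidable R) →
              P ⊆ Q ∪ R → count P? ≤ count Q? + count R?
count-cover {n = zero}  P? Q? R? P⊆Q∪R = z≤n
count-cover {n = suc n} P? Q? R? P⊆Q∪R = begin
  indicator (P? zero) + count (P? ∘ suc)
    ≤⟨ +-mono-≤ (indicator-cover P⊆Q∪R (P? zero) (Q? zero) (R? zero))
                (count-cover (P? ∘ suc) (Q? ∘ suc) (R? ∘ suc) P⊆Q∪R) ⟩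
  (indicator (Q? zero) + indicator (R? zero)) + (count (Q? ∘ suc) + count (R? ∘ suc))
    ≡⟨ interchange +-commutativeSemigroup (indicator (Q? zero)) _ _ _ ⟩
  (indicator (Q? zero) + count (Q? ∘ suc)) + (indicator (R? zero) + count (R? ∘ suc)) ∎
  where open ≤-Reasoning

count-disjoint-∪ : ∀ {n} {Q : Pred (Fin n) ℓ₁} {R : Pred (Fin n) ℓ₂} (Q? : Decidable Q) (R? : Decidable R) →
                   (∀ {x} → Q x → R x → ⊥) → count (Q? ∪? R?) ≡ count Q? + count R?
count-disjoint-∪ {n = zero}  Q? R? Q⊥R = refl
count-disjoint-∪ {n = suc n} Q? R? Q⊥R = begin
  indicator (Q? zero ⊎-dec R? zero) + count ((Q? ∘ suc) ∪? (R? ∘ suc))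
    ≡⟨ cong₂ _+_ (indicator-disjoint Q⊥R (Q? zero) (R? zero))
                 (count-disjoint-∪ (Q? ∘ suc) (R? ∘ suc) Q⊥R) ⟩
  (indicator (Q? zero) + indicator (R? zero)) + (count (Q? ∘ suc) + count (R? ∘ suc))
    ≡⟨ interchange +-commutativeSemigroup (indicator (Q? zero)) _ _ _ ⟩
  (indicator (Q? zero) + count (Q? ∘ suc)) + (indicator (R? zero) + count (R? ∘ suc)) ∎
  where open ≡-Reasoning

count-∅ : ∀ {n} {P : Pred (Fin n) ℓ} (P? : Decidable P) → Empty P → count P? ≡ 0
count-∅ {n = zero}  P? P-empty = refl
count-∅ {n = suc n} P? P-empty with P? zero
... | yes p = contradiction p (P-empty zero)
... | no  _ = count-∅ (P? ∘ suc) (P-empty ∘ suc)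

count-U : ∀ {n} → count (U? {A = Fin n}) ≡ n
count-U {n = zero}  = refl
count-U {n = suc n} = cong suc count-U

count-｛｝ : ∀ {n} (y : Fin n) → count ｛ y ｝? ≡ 1
count-｛｝ {suc n} zero    = cong suc (count-∅ (λ (x : Fin n) → zero ≟ suc x) λ _ ())
count-｛｝ {suc n} (suc y) =
  trans (count-cong (λ x → suc y ≟ suc x) ｛ y ｝? suc-injective (cong suc)) (count-｛｝ y)

count-remove : ∀ {n} {P : Pred (Fin n) ℓ} (P? : Decidable P) {y : Fin n} → P y →
               count P? ≡ suc (count (P? ∖? ｛ y ｝?))
count-remove {P = P} P? {y} py = begin
  count P?
    ≡⟨ count-cong P? (｛ y ｝? ∪? (P? ∖? ｛ y ｝?)) split join ⟩
  count (｛ y ｝? ∪? (P? ∖? ｛ y ｝?))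
    ≡⟨ count-disjoint-∪ ｛ y ｝? (P? ∖? ｛ y ｝?) (λ y≡x (_ , y≢x) → y≢x y≡x) ⟩
  count ｛ y ｝? + count (P? ∖? ｛ y ｝?)
    ≡⟨ cong (_+ count (P? ∖? ｛ y ｝?)) (count-｛｝ y) ⟩
  suc (count (P? ∖? ｛ y ｝?)) ∎
  where
  open ≡-Reasoning
  split : P ⊆ ｛ y ｝ ∪ (P ∖ ｛ y ｝)
  split {x} px with y ≟ x
  ... | yes y≡x = inj₁ y≡x
  ... | no  y≢x = inj₂ (px , y≢x)
  join : ｛ y ｝ ∪ (P ∖ ｛ y ｝) ⊆ P
  join (inj₁ refl)     = py
  join (inj₂ (px , _)) = px

count-satisfiable : ∀ {n} {P : Pred (Fin n) ℓ} (P? : Decidable P) → 0 < count P? → Satisfiable P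
count-satisfiable {n = suc n} P? 0<count with P? zero
... | yes p = zero , p
... | no  _ with x , px ← count-satisfiable (P? ∘ suc) 0<count = suc x , px

count-<⇒∖-satisfiable : ∀ {n} {P : Pred (Fin n) ℓ₁} {Q : Pred (Fin n) ℓ₂}
                        (P? : Decidable P) (Q? : Decidable Q) → count Q? < count P? → Satisfiable (P ∖ Q)
count-<⇒∖-satisfiable {P = P} {Q = Q} P? Q? Q<P =
  count-satisfiable (P? ∖? Q?)
    (+-cancelˡ-< (count Q?) 0 _
      (subst (_< count Q? + count (P? ∖? Q?)) (≡-sym (+-identityʳ (count Q?))) (<-≤-trans Q<P cover)))
  where
  split : P ⊆ Q ∪ (P ∖ Q)
  split {x} px with Q? x
  ... | yes qx = inj₁ qx
  ... | no ¬qx = inj₂ (px , ¬qx)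
  cover : count P? ≤ count Q? + count (P? ∖? Q?)
  cover = count-cover P? Q? (P? ∖? Q?) split

count-⋃ : ∀ {m n} {P : Pred (Fin n) ℓ} {S : Pred (Fin m) ℓ₁} (S? : Decidable S)
          {F : Fin m → Pred (Fin n) ℓ₂} (F? : ∀ a → Decidable (F a)) (P? : Decidable P) {d : ℕ} →
          (∀ {a} → S a → count (F? a) ≤ d) →
          (∀ {x} → P x → ∃ λ a → S a × F a x) → count P? ≤ count S? * d
count-⋃ {m = zero}  S? F? P? F≤d P⊆⋃ = ≤-reflexive (count-∅ P? λ _ px → ¬Fin0 (proj₁ (P⊆⋃ px)))
count-⋃ {m = suc m} {P = P} {S = S} S? {F} F? P? F≤d P⊆⋃ with S? zero
... | no ¬s = count-⋃ (S? ∘ suc) (F? ∘ suc) P? F≤d later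
  where
  later : ∀ {x} → P x → ∃ λ a → S (suc a) × F (suc a) x
  later px with P⊆⋃ px
  ... | zero  , s , _ = contradiction s ¬s
  ... | suc a , s , f = a , s , f
... | yes s = ≤-trans (count-cover P? (F? zero) (P? ∖? F? zero) split)
                      (+-mono-≤ (F≤d s) (count-⋃ (S? ∘ suc) (F? ∘ suc) (P? ∖? F? zero) F≤d later))
  where
  split : P ⊆ F zero ∪ (P ∖ F zero)
  split {x} px with F? zero x
  ... | yes f = inj₁ f
  ... | no ¬f = inj₂ (px , ¬f)
  later : ∀ {x} → (P ∖ F zero) x → ∃ λ a → S (suc a) × F (suc a) x
  later (px , ¬f) with P⊆⋃ px
  ... | zero  , _ , f = contradiction f ¬f
  ... | suc a , s , f = a , s , f

record PredInjection {m n} (P : Pred (Fin m) ℓ₁) (Q : Pred (Fin n) ℓ₂) : Set (ℓ₁ ⊔ ℓ₂) where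
  field
    to        : ∀ {x} → P x → Fin n
    to-∈      : ∀ {x} (px : P x) → Q (to px)
    injective : ∀ {x y} (px : P x) (py : P y) → to px ≡ to py → x ≡ y
open PredInjection

private
  skip-zero : ∀ {m n} {P : Pred (Fin (suc m)) ℓ₁} {Q : Pred (Fin n) ℓ₂} →
              ¬ P zero → PredInjection (P ∘ suc) Q → PredInjection P Q
  skip-zero ¬p0 ι .to {zero}  p0 = contradiction p0 ¬p0
  skip-zero ¬p0 ι .to {suc x} px = ι .to px
  skip-zero ¬p0 ι .to-∈ {zero}  p0 = contradiction p0 ¬p0
  skip-zero ¬p0 ι .to-∈ {suc x} px = ι .to-∈ px
  skip-zero ¬p0 ι .injective {zero}  p0 _  _  = contradiction p0 ¬p0
  skip-zero ¬p0 ι .injective {suc _} {zero}  _ p0 _  = contradiction p0 ¬p0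
  skip-zero ¬p0 ι .injective {suc _} {suc _} px py eq = cong suc (ι .injective px py eq)

  send-zero : ∀ {m n} {P : Pred (Fin (suc m)) ℓ₁} {Q : Pred (Fin n) ℓ₂} {y : Fin n} →
              Q y → PredInjection (P ∘ suc) (Q ∖ ｛ y ｝) → PredInjection P Q
  send-zero {y = y} qy ι .to {zero}  _  = y
  send-zero {y = y} qy ι .to {suc x} px = ι .to px
  send-zero qy ι .to-∈ {zero}  _  = qy
  send-zero qy ι .to-∈ {suc x} px = proj₁ (ι .to-∈ px)
  send-zero qy ι .injective {zero}  {zero}  _  _  _  = refl
  send-zero qy ι .injective {zero}  {suc _} _  py eq = contradiction eq (proj₂ (ι .to-∈ py))
  send-zero qy ι .injective {suc _} {zero}  px _  eq = contradiction (≡-sym eq) (proj₂ (ι .to-∈ px))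
  send-zero qy ι .injective {suc _} {suc _} px py eq = cong suc (ι .injective px py eq)

  restrict-suc : ∀ {m n} {P : Pred (Fin (suc m)) ℓ₁} {Q : Pred (Fin n) ℓ₂} →
                 PredInjection P Q → PredInjection (P ∘ suc) Q
  restrict-suc ι .to        = ι .to
  restrict-suc ι .to-∈      = ι .to-∈
  restrict-suc ι .injective px py eq = suc-injective (ι .injective px py eq)

  restrict-avoiding : ∀ {m n} {P : Pred (Fin (suc m)) ℓ₁} {Q : Pred (Fin n) ℓ₂} (ι : PredInjection P Q)
                      (p0 : P zero) → PredInjection (P ∘ suc) (Q ∖ ｛ ι .to p0 ｝)
  restrict-avoiding ι p0 .to        = ι .to
  restrict-avoiding ι p0 .to-∈ px   = ι .to-∈ px , 0≢1+n ∘ ι .injective p0 px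
  restrict-avoiding ι p0 .injective px py eq = suc-injective (ι .injective px py eq)

count-≤⇒injection : ∀ {m n} {P : Pred (Fin m) ℓ₁} {Q : Pred (Fin n) ℓ₂}
                    (P? : Decidable P) (Q? : Decidable Q) → count P? ≤ count Q? → PredInjection P Q
count-≤⇒injection {m = zero} P? Q? _ =
  record { to = λ { {()} } ; to-∈ = λ { {()} } ; injective = λ { {()} } }
count-≤⇒injection {m = suc m} P? Q? P≤Q with P? zero
... | no ¬p0 = skip-zero ¬p0 (count-≤⇒injection (P? ∘ suc) Q? P≤Q)
... | yes _ with y , qy ← count-satisfiable Q? (≤-trans (s≤s z≤n) P≤Q) =
  send-zero qy (count-≤⇒injection (P? ∘ suc) (Q? ∖? ｛ y ｝?)
                  (s≤s⁻¹ (≤-trans P≤Q (≤-reflexive (count-remove Q? qy)))))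

injection⇒count-≤ : ∀ {m n} {P : Pred (Fin m) ℓ₁} {Q : Pred (Fin n) ℓ₂}
                    (P? : Decidable P) (Q? : Decidable Q) → PredInjection P Q → count P? ≤ count Q?
injection⇒count-≤ {m = zero} P? Q? ι = z≤n
injection⇒count-≤ {m = suc m} P? Q? ι with P? zero
... | no _   = injection⇒count-≤ (P? ∘ suc) Q? (restrict-suc ι)
... | yes p0 =
  ≤-trans (s≤s (injection⇒count-≤ (P? ∘ suc) (Q? ∖? ｛ ι .to p0 ｝?) (restrict-avoiding ι p0)))
          (≤-reflexive (≡-sym (count-remove Q? (ι .to-∈ p0))))

Distinct : ∀ {n} → ℕ → Pred (Fin n) ℓ → Set ℓ
Distinct {n = n} t P = Σ (Fin t → Fin n) λ f → Injective _≡_ _≡_ f × (∀ i → f i ∈ P)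

count-≥⇒distinct : ∀ {n t} {P : Pred (Fin n) ℓ} (P? : Decidable P) → t ≤ count P? → Distinct t P
count-≥⇒distinct {P = P} P? t≤P = (λ i → to ι {i} _) , injective ι _ _ , λ i → to-∈ ι {i} _
  where
  ι : PredInjection U P
  ι = count-≤⇒injection U? P? (≤-trans (≤-reflexive count-U) t≤P)

distinct⇒count-≥ : ∀ {n t} {P : Pred (Fin n) ℓ} (P? : Decidable P) → Distinct t P → t ≤ count P?
distinct⇒count-≥ P? (f , f-injective , f∈P) =
  ≤-trans (≤-reflexive (≡-sym count-U)) (injection⇒count-≤ U? P? ι)
  where
  ι : PredInjection U _
  ι = record { to = λ {i} _ → f i ; to-∈ = λ {i} _ → f∈P i ; injective = λ _ _ → f-injective }

count-≤-fibres : ∀ {n k} {P : Pred (Fin n) ℓ} (f : Fin n → Fin k) (P? : Decidable P) {t : ℕ} →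
                 (∀ c → count ((λ x → f x ≟ c) ∩? P?) ≤ t) → count P? ≤ k * t
count-≤-fibres {k = k} f P? {t} fibre≤t = ≤-trans
  (count-⋃ U? (λ c → (λ x → f x ≟ c) ∩? P?) P? (λ {c} _ → fibre≤t c) λ {x} px → f x , _ , refl , px)
  (≤-reflexive (cong (_* t) (count-U {n = k})))

pigeonhole-≤ : ∀ {n k} (f : Fin n → Fin k) {t : ℕ} → (∀ c → count (λ x → f x ≟ c) ≤ t) → n ≤ k * t
pigeonhole-≤ f fibre≤t = ≤-trans (≤-reflexive (≡-sym count-U)) (count-≤-fibres f U? λ c →
  ≤-trans (count-mono ((λ x → f x ≟ c) ∩? U?) (λ x → f x ≟ c) proj₁) (fibre≤t c))

-- Adjacency and small induced subgraphs

Adj : Graph n → Fin n → Pred (Fin n) 0ℓ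
Adj G x y = adj G x y ≡ true

NonAdj : Graph n → Fin n → Pred (Fin n) 0ℓ
NonAdj G x y = adj G x y ≡ false

adj? : (G : Graph n) (x : Fin n) → Decidable (Adj G x)
adj? G x y = adj G x y Bool.≟ true

nonAdj? : (G : Graph n) (x : Fin n) → Decidable (NonAdj G x)
nonAdj? G x y = adj G x y Bool.≟ false

flip-adj : (G : Graph n) {x y : Fin n} {b : Bool} → adj G x y ≡ b → adj G y x ≡ b
flip-adj G {x} {y} x~y = trans (sym G y x) x~y

adjacent⇒distinct : (G : Graph n) {x y : Fin n} → adj G x y ≡ true → x ≢ y
adjacent⇒distinct G {x} x~y refl = not-¬ x~y (irrefl G x)

separated⇒distinct : (G : Graph n) {x y z : Fin n} → adj G x z ≡ true → adj G y z ≡ false → x ≢ y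
separated⇒distinct G x~z y≁z refl = not-¬ x~z y≁z

Independent : Graph n → Pred (Fin n) 0ℓ → Set
Independent G I = ∀ {x y} → x ∈ I → y ∈ I → adj G x y ≡ false

colour-class-independent : (G : Graph n) ((col , _) : Colouring k G) (c : Fin k) →
                           Independent G (λ x → col x ≡ c)
colour-class-independent G (col , col-proper) c {x} {y} refl cy =
  ¬-not λ x~y → col-proper x y x~y (≡-sym cy)

TwinFree : Graph m → Set
TwinFree H = ∀ i j → (∀ k → adj H i k ≡ adj H j k) → i ≡ j

twinFree? : (H : Graph m) → Dec (TwinFree H)
twinFree? H = all? λ i → all? λ j → all? (λ k → adj H i k Bool.≟ adj H j k) →-dec (i ≟ j)

twinFree-induced : (H : Graph m) (G : Graph n) → TwinFree H → (f : Fin m → Fin n) →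
                   (∀ i j → adj H i j ≡ adj G (f i) (f j)) → InducedSubgraph H G
twinFree-induced H G twinFree f pres = f , f-injective , pres
  where
  f-injective : ∀ {i j} → f i ≡ f j → i ≡ j
  f-injective {i} {j} fi≡fj = twinFree i j λ k →
    trans (pres i k) (trans (cong (λ v → adj G v (f k)) fi≡fj) (≡-sym (pres j k)))

P5-twinFree : TwinFree P5
P5-twinFree = toWitness {a? = twinFree? P5} _

path-induced : (G : Graph n) (p₀ p₁ p₂ p₃ p₄ : Fin n) →
  adj G p₀ p₁ ≡ true → adj G p₁ p₂ ≡ true → adj G p₂ p₃ ≡ true → adj G p₃ p₄ ≡ true →
  adj G p₀ p₂ ≡ false → adj G p₀ p₃ ≡ false → adj G p₀ p₄ ≡ false →
  adj G p₁ p₃ ≡ false → adj G p₁ p₄ ≡ false → adj G p₂ p₄ ≡ false →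
  InducedSubgraph P5 G
path-induced G p₀ p₁ p₂ p₃ p₄ e₀₁ e₁₂ e₂₃ e₃₄ n₀₂ n₀₃ n₀₄ n₁₃ n₁₄ n₂₄ =
  twinFree-induced P5 G P5-twinFree p pres
  where
  p : Fin 5 → Fin _
  p zero                         = p₀
  p (suc zero)                   = p₁
  p (suc (suc zero))             = p₂
  p (suc (suc (suc zero)))       = p₃
  p (suc (suc (suc (suc zero)))) = p₄

  flipped : ∀ {b x y} → adj G x y ≡ b → b ≡ adj G y x
  flipped = ≡-sym ∘ flip-adj G

  pres : ∀ i j → adj P5 i j ≡ adj G (p i) (p j)
  pres zero zero                                                   = ≡-sym (irrefl G p₀)
  pres zero (suc zero)                                             = ≡-sym e₀₁
  pres zero (suc (suc zero))                                       = ≡-sym n₀₂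
  pres zero (suc (suc (suc zero)))                                 = ≡-sym n₀₃
  pres zero (suc (suc (suc (suc zero))))                           = ≡-sym n₀₄
  pres (suc zero) zero                                             = flipped e₀₁
  pres (suc zero) (suc zero)                                       = ≡-sym (irrefl G p₁)
  pres (suc zero) (suc (suc zero))                                 = ≡-sym e₁₂
  pres (suc zero) (suc (suc (suc zero)))                           = ≡-sym n₁₃
  pres (suc zero) (suc (suc (suc (suc zero))))                     = ≡-sym n₁₄
  pres (suc (suc zero)) zero                                       = flipped n₀₂
  pres (suc (suc zero)) (suc zero)                                 = flipped e₁₂
  pres (suc (suc zero)) (suc (suc zero))                           = ≡-sym (irrefl G p₂)
  pres (suc (suc zero)) (suc (suc (suc zero)))                     = ≡-sym e₂₃
  pres (suc (suc zero)) (suc (suc (suc (suc zero))))               = ≡-sym n₂₄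
  pres (suc (suc (suc zero))) zero                                 = flipped n₀₃
  pres (suc (suc (suc zero))) (suc zero)                           = flipped n₁₃
  pres (suc (suc (suc zero))) (suc (suc zero))                     = flipped e₂₃
  pres (suc (suc (suc zero))) (suc (suc (suc zero)))               = ≡-sym (irrefl G p₃)
  pres (suc (suc (suc zero))) (suc (suc (suc (suc zero))))         = ≡-sym e₃₄
  pres (suc (suc (suc (suc zero)))) zero                           = flipped n₀₄
  pres (suc (suc (suc (suc zero)))) (suc zero)                     = flipped n₁₄
  pres (suc (suc (suc (suc zero)))) (suc (suc zero))               = flipped n₂₄
  pres (suc (suc (suc (suc zero)))) (suc (suc (suc zero)))         = flipped e₃₄
  pres (suc (suc (suc (suc zero)))) (suc (suc (suc (suc zero)))) = ≡-sym (irrefl G p₄)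

data StarRole : Set where
  centre   : StarRole
  leaf     : Fin 4 → StarRole
  isolated : StarRole

role : Fin 6 → StarRole
role zero                                = centre
role (suc zero)                          = leaf zero
role (suc (suc zero))                    = leaf (suc zero)
role (suc (suc (suc zero)))              = leaf (suc (suc zero))
role (suc (suc (suc (suc zero))))        = leaf (suc (suc (suc zero)))
role (suc (suc (suc (suc (suc zero))))) = isolated

place : StarRole → Fin 6
place centre   = zero
place (leaf i) = suc (inject₁ i)
place isolated = fromℕ 5

place-role : ∀ i → place (role i) ≡ i
place-role = toWitness {a? = all? λ i → place (role i) ≟ i} _

roleAdj : StarRole → StarRole → Bool
roleAdj centre   (leaf _) = true
roleAdj (leaf _) centre   = true
roleAdj _        _        = false

K14+P1-roles : ∀ i j → adj K14+P1 i j ≡ roleAdj (role i) (role j)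
K14+P1-roles =
  toWitness {a? = all? λ i → all? λ j → adj K14+P1 i j Bool.≟ roleAdj (role i) (role j)} _

star+isolated-induced : (G : Graph n) (c u : Fin n) (l : Fin 4 → Fin n) → Injective _≡_ _≡_ l →
  (∀ i → adj G c (l i) ≡ true) → adj G c u ≡ false →
  (∀ i j → adj G (l i) (l j) ≡ false) → (∀ i → adj G (l i) u ≡ false) →
  InducedSubgraph K14+P1 G
star+isolated-induced G c u l l-injective c~l c≁u l≁l l≁u =
  vertex ∘ role , role-vertex-injective , pres
  where
  vertex : StarRole → Fin _
  vertex centre   = c
  vertex (leaf i) = l i
  vertex isolated = u

  vertex-adj : ∀ r s → roleAdj r s ≡ adj G (vertex r) (vertex s)
  vertex-adj centre   centre   = ≡-sym (irrefl G c)
  vertex-adj centre   (leaf j) = ≡-sym (c~l j)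
  vertex-adj centre   isolated = ≡-sym c≁u
  vertex-adj (leaf i) centre   = ≡-sym (flip-adj G (c~l i))
  vertex-adj (leaf i) (leaf j) = ≡-sym (l≁l i j)
  vertex-adj (leaf i) isolated = ≡-sym (l≁u i)
  vertex-adj isolated centre   = ≡-sym (flip-adj G c≁u)
  vertex-adj isolated (leaf j) = ≡-sym (flip-adj G (l≁u j))
  vertex-adj isolated isolated = ≡-sym (irrefl G u)

  c≢u : c ≢ u
  c≢u = separated⇒distinct G (c~l zero) (flip-adj G (l≁u zero))

  l≢u : ∀ i → l i ≢ u
  l≢u i = separated⇒distinct G (flip-adj G (c~l i)) (flip-adj G c≁u)

  vertex-injective : ∀ {r s} → vertex r ≡ vertex s → r ≡ s
  vertex-injective {centre}   {centre}   _  = refl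
  vertex-injective {centre}   {leaf j}   eq = contradiction eq (adjacent⇒distinct G (c~l j))
  vertex-injective {centre}   {isolated} eq = contradiction eq c≢u
  vertex-injective {leaf i}   {centre}   eq = contradiction (≡-sym eq) (adjacent⇒distinct G (c~l i))
  vertex-injective {leaf i}   {leaf j}   eq = cong leaf (l-injective eq)
  vertex-injective {leaf i}   {isolated} eq = contradiction eq (l≢u i)
  vertex-injective {isolated} {centre}   eq = contradiction (≡-sym eq) c≢u
  vertex-injective {isolated} {leaf j}   eq = contradiction (≡-sym eq) (l≢u j)
  vertex-injective {isolated} {isolated} _  = refl

  role-vertex-injective : ∀ {i j} → vertex (role i) ≡ vertex (role j) → i ≡ j
  role-vertex-injective {i} {j} eq =
    trans (≡-sym (place-role i))
          (trans (cong place (vertex-injective {role i} {role j} eq)) (place-role j))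

  pres : ∀ i j → adj K14+P1 i j ≡ adj G (vertex (role i)) (vertex (role j))
  pres i j = trans (K14+P1-roles i j) (vertex-adj (role i) (role j))

module _ (G : Graph n) (K-free : ¬ InducedSubgraph K14+P1 G) where

  -- Four such vertices would be the leaves of an induced K1,4 centred at c, with u isolated.
  private-neighbours≤3 : {I : Pred (Fin n) 0ℓ} (I? : Decidable I) → Independent G I →
    ∀ {c u} → adj G c u ≡ false → count (I? ∩? adj? G c ∩? nonAdj? G u) ≤ 3
  private-neighbours≤3 {I} I? I-independent {c} {u} c≁u =
    ≮⇒≥ (no-star ∘ count-≥⇒distinct (I? ∩? adj? G c ∩? nonAdj? G u))
    where
    no-star : ¬ Distinct 4 (I ∩ Adj G c ∩ NonAdj G u)
    no-star (l , l-injective , l∈) = K-free (star+isolated-induced G c u l l-injective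
      (proj₁ ∘ proj₂ ∘ l∈) c≁u (λ i j → I-independent (proj₁ (l∈ i)) (proj₁ (l∈ j)))
      (flip-adj G ∘ proj₂ ∘ proj₂ ∘ l∈))

  private-neighbours≤3k : Colouring k G → ∀ {c u} → adj G c u ≡ false →
    count (adj? G c ∩? nonAdj? G u) ≤ k * 3
  private-neighbours≤3k colouring@(col , _) c≁u = count-≤-fibres col (adj? G _ ∩? nonAdj? G _) λ c →
    private-neighbours≤3 (λ x → col x ≟ c) (colour-class-independent G colouring c) c≁u

-- Colourings of vertex-deleted graphs and anticomplete splits

-- Encodes a j-colouring of G − v: colours are shifted up by one and v alone gets colour zero.
record ColouringFreshAt (j : ℕ) (G : Graph n) (v : Fin n) : Set where
  field
    colour : Fin n → Fin (suc j)
    proper : ∀ x y → adj G x y ≡ true → colour x ≢ colour y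
    fresh⇒v : ∀ {x} → colour x ≡ zero → x ≡ v
open ColouringFreshAt

deletion-colouring⇒fresh : (G : Graph (suc m)) (v : Fin (suc m)) →
                           Colouring j (deleteVertex G v) → ColouringFreshAt j G v
deletion-colouring⇒fresh G v (c , c-proper) =
  record { colour = ψ ; proper = ψ-proper ; fresh⇒v = ψ-fresh }
  where
  ψ : Fin _ → Fin _
  ψ x with v ≟ x
  ... | yes _   = zero
  ... | no v≢x  = suc (c (punchOut v≢x))
  ψ-proper : ∀ x y → adj G x y ≡ true → ψ x ≢ ψ y
  ψ-proper x y x~y with v ≟ x | v ≟ y
  ... | yes refl | yes refl = contradiction refl (adjacent⇒distinct G x~y)
  ... | yes _    | no _     = 0≢1+n
  ... | no _     | yes _    = 0≢1+n ∘ ≡-sym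
  ... | no v≢x   | no v≢y   = c-proper _ _ x~y′ ∘ suc-injective
    where
    x~y′ : adj G (punchIn v (punchOut v≢x)) (punchIn v (punchOut v≢y)) ≡ true
    x~y′ = subst₂ (λ a b → adj G a b ≡ true)
                  (≡-sym (punchIn-punchOut v≢x)) (≡-sym (punchIn-punchOut v≢y)) x~y
  ψ-fresh : ∀ {x} → ψ x ≡ zero → x ≡ v
  ψ-fresh {x} with v ≟ x
  ... | yes v≡x = λ _ → ≡-sym v≡x
  ... | no _    = λ ()

avoiding-fresh⇒colouring : (G : Graph n) (ψ : Fin n → Fin (suc j)) →
                           (∀ x y → adj G x y ≡ true → ψ x ≢ ψ y) → (∀ x → zero ≢ ψ x) → Colouring j G
avoiding-fresh⇒colouring G ψ ψ-proper avoids =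
  (λ x → punchOut (avoids x)) ,
  λ x y x~y → ψ-proper x y x~y ∘ punchOut-injective (avoids x) (avoids y)

Used : {G : Graph n} {v : Fin n} → ColouringFreshAt j G v → Pred (Fin n) 0ℓ → Pred (Fin (suc j)) 0ℓ
Used ψ X col = ∃ λ x → X x × colour ψ x ≡ col

used? : {G : Graph n} {v : Fin n} (ψ : ColouringFreshAt j G v) {X : Pred (Fin n) 0ℓ} →
        Decidable X → Decidable (Used ψ X)
used? ψ X? col = any? λ x → X? x ×-dec (colour ψ x ≟ col)

record AnticompleteSplit (G : Graph n) : Set₁ where
  field
    A B C        : Pred (Fin n) 0ℓ
    A?           : Decidable A
    B?           : Decidable B
    C?           : Decidable C
    covers       : ∀ x → x ∈ A ∪ B ∪ C
    disjoint     : ∀ {x} → x ∈ A → x ∉ B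
    anticomplete : ∀ {x y} → x ∈ A → y ∈ B → adj G x y ≡ false
    complete     : ∀ {x y} → x ∈ C → y ∈ A ∪ B → adj G x y ≡ true
    a b          : Fin n
    a∈A          : a ∈ A
    b∈B          : b ∈ B

swap-split : {G : Graph n} → AnticompleteSplit G → AnticompleteSplit G
swap-split {G = G} S = record
  { A = B ; B = A ; C = C ; A? = B? ; B? = A? ; C? = C?
  ; covers = λ x → [ inj₂ ∘ inj₁ , [ inj₁ , inj₂ ∘ inj₂ ] ] (covers x)
  ; disjoint = λ bx ax → disjoint ax bx
  ; anticomplete = λ bx ay → flip-adj G (anticomplete ay bx)
  ; complete = λ cx → complete cx ∘ swap
  ; a = b ; b = a ; a∈A = b∈B ; b∈B = a∈A
  }
  where open AnticompleteSplit S

module _ {G : Graph n} (S : AnticompleteSplit G) where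
  open AnticompleteSplit S

  Free : {v : Fin n} → ColouringFreshAt j G v → Pred (Fin (suc j)) 0ℓ
  Free ψ col = zero ≢ col × col ∉ Used ψ C

  free? : {v : Fin n} (ψ : ColouringFreshAt j G v) → Decidable (Free ψ)
  free? ψ col = ¬? (zero ≟ col) ×-dec ¬? (used? ψ C? col)

  used-on-A⊆free : (φ : ColouringFreshAt j G b) → Used φ A ⊆ Free φ
  used-on-A⊆free φ (x , ax , refl) = not-fresh , not-on-C
    where
    not-fresh : zero ≢ colour φ x
    not-fresh eq = disjoint ax (subst (λ y → y ∈ B) (≡-sym (fresh⇒v φ (≡-sym eq))) b∈B)
    not-on-C : colour φ x ∉ Used φ C
    not-on-C (y , cy , φy≡φx) = proper φ y x (complete cy (inj₁ ax)) φy≡φx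

  recolour : {ja jb : ℕ} (ψ : ColouringFreshAt ja G a) (φ : ColouringFreshAt jb G b) →
             PredInjection (Used φ A) (Free ψ) → Colouring ja G
  recolour ψ φ ι = avoiding-fresh⇒colouring G χ χ-proper χ-avoids
    where
    χ-at : ∀ x → Dec (x ∈ A) → Fin _
    χ-at x (yes ax) = to ι (x , ax , refl)
    χ-at x (no _)   = colour ψ x
    χ : Fin n → Fin _
    χ x = χ-at x (A? x)
    mixed : ∀ {x y} (ax : x ∈ A) → y ∉ A → adj G x y ≡ true → to ι (x , ax , refl) ≢ colour ψ y
    mixed {x} {y} ax ¬ay x~y eq with covers y
    ... | inj₁ ay        = ¬ay ay
    ... | inj₂ (inj₁ by) = not-¬ x~y (anticomplete ax by)
    ... | inj₂ (inj₂ cy) = proj₂ (to-∈ ι (x , ax , refl)) (y , cy , ≡-sym eq)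
    χ-proper : ∀ x y → adj G x y ≡ true → χ x ≢ χ y
    χ-proper x y x~y with A? x | A? y
    ... | yes ax | yes ay = proper φ x y x~y ∘ injective ι (x , ax , refl) (y , ay , refl)
    ... | yes ax | no ¬ay = mixed ax ¬ay x~y
    ... | no ¬ax | yes ay = mixed ay ¬ax (flip-adj G x~y) ∘ ≡-sym
    ... | no _   | no _   = proper ψ x y x~y
    χ-avoids : ∀ x → zero ≢ χ x
    χ-avoids x with A? x
    ... | yes ax = proj₁ (to-∈ ι (x , ax , refl))
    ... | no ¬ax = λ eq → ¬ax (subst (λ y → y ∈ A) (≡-sym (fresh⇒v ψ (≡-sym eq))) a∈A)

-- φ uses at most |Free φ| colours on A and ψ at most |Free ψ| on B, so whichever of ψ, φ has
-- more free colours can absorb the other side.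
anticomplete-split-colourable : {G : Graph n} (S : AnticompleteSplit G) {ja jb : ℕ} →
  ColouringFreshAt ja G (AnticompleteSplit.a S) → ColouringFreshAt jb G (AnticompleteSplit.b S) →
  Colouring ja G ⊎ Colouring jb G
anticomplete-split-colourable S ψ φ with ≤-total (count (free? S φ)) (count (free? S ψ))
... | inj₁ φ≤ψ = inj₁ (recolour S ψ φ (count-≤⇒injection (used? φ A?) (free? S ψ)
                   (≤-trans (count-mono (used? φ A?) (free? S φ) (used-on-A⊆free S φ)) φ≤ψ)))
  where open AnticompleteSplit S
... | inj₂ ψ≤φ = inj₂ (recolour S′ φ ψ (count-≤⇒injection (used? ψ B?) (free? S′ φ)
                   (≤-trans (count-mono (used? ψ B?) (free? S′ ψ) (used-on-A⊆free S′ ψ)) ψ≤φ)))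
  where
  open AnticompleteSplit S
  S′ : AnticompleteSplit _
  S′ = swap-split S

critical⇒fresh-colourings : {G : Graph (suc m)} →
                            (∀ v → ChromaticLessThan (deleteVertex G v) k) → ∀ v → ∃ λ j → j < k × ColouringFreshAt j G v
critical⇒fresh-colourings {G = G} critical v with j , j<k , (c , _) ← critical v =
  j , j<k , deletion-colouring⇒fresh G v c

critical⇒no-anticomplete-split : {G : Graph n} {k : ℕ} → VertexCritical k G → ¬ AnticompleteSplit G
critical⇒no-anticomplete-split {n = zero}  _ S with () ← AnticompleteSplit.a S
critical⇒no-anticomplete-split {n = suc m} ((_ , uncolourable) , critical) S
  with ja , ja<k , ψ ← critical⇒fresh-colourings critical (AnticompleteSplit.a S)
     | jb , jb<k , φ ← critical⇒fresh-colourings critical (AnticompleteSplit.b S)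
  = [ uncolourable ja ja<k , uncolourable jb jb<k ] (anticomplete-split-colourable S ψ φ)

-- Balls in the subgraph induced by a vertex set

module Ball (G : Graph n) {S : Pred (Fin n) 0ℓ} (S? : Decidable S) (x : Fin n) where

  Within : ℕ → Pred (Fin n) 0ℓ
  Within zero      = ｛ x ｝
  Within (suc r) z = Within r z ⊎ (S z × ∃ λ y → Within r y × adj G y z ≡ true)

  within? : ∀ r → Decidable (Within r)
  within? zero      = ｛ x ｝?
  within? (suc r) z = within? r z ⊎-dec (S? z ×-dec any? λ y → within? r y ×-dec adj? G y z)

  private
    variable
      r : ℕ
      y z w : Fin n

  within-step : y ∈ Within r → adj G y z ≡ true → S z → z ∈ Within (suc r)
  within-step y∈W y~z sz = inj₂ (sz , _ , y∈W , y~z)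

  outside-nonadjacent : y ∈ Within r → S z → z ∉ Within (suc r) → adj G y z ≡ false
  outside-nonadjacent y∈W sz z∉W = ¬-not λ y~z → z∉W (within-step y∈W y~z sz)

  last-step : z ∈ Within (suc r) → z ∉ Within r → S z × ∃ λ y → y ∈ Within r × adj G y z ≡ true
  last-step (inj₁ z∈W) z∉W = contradiction z∈W z∉W
  last-step (inj₂ step) _  = step

  within-S : S x → z ∈ Within r → S z
  within-S {r = zero}  sx refl           = sx
  within-S {r = suc r} sx (inj₁ z∈W)     = within-S sx z∈W
  within-S {r = suc r} sx (inj₂ (sz , _)) = sz

  count-within : {Δ : ℕ} → S x → (∀ {y} → S y → count (S? ∩? adj? G y) ≤ Δ) →
                 ∀ r → count (within? r) ≤ suc Δ ^ r
  count-within sx degree zero    = ≤-reflexive (count-｛｝ x)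
  count-within {Δ} sx degree (suc r) = ≤-trans
    (count-⋃ (within? r) (λ y → ｛ y ｝? ∪? (S? ∩? adj? G y)) (within? (suc r)) ball-degree cover)
    (≤-trans (*-monoˡ-≤ (suc Δ) (count-within sx degree r))
             (≤-reflexive (*-comm (suc Δ ^ r) (suc Δ))))
    where
    ball-degree : ∀ {y} → y ∈ Within r → count (｛ y ｝? ∪? (S? ∩? adj? G y)) ≤ suc Δ
    ball-degree {y} y∈W = ≤-trans (count-cover _ ｛ y ｝? (S? ∩? adj? G y) id)
                                (+-mono-≤ (≤-reflexive (count-｛｝ y)) (degree (within-S sx y∈W)))
    cover : ∀ {z} → z ∈ Within (suc r) → ∃ λ y → y ∈ Within r × (y ≡ z ⊎ (S z × adj G y z ≡ true))
    cover (inj₁ z∈W)                  = _ , z∈W , inj₁ refl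
    cover (inj₂ (sz , y , y∈W , y~z)) = y , y∈W , inj₂ (sz , y~z)

  outside-neighbour : adj G z w ≡ true → S w → w ∉ Within (suc r) → z ∉ Within r
  outside-neighbour z~w sw w∉W z∈W = w∉W (within-step z∈W z~w sw)

  -- x, a, y, z, w is a shortest path from x, hence induced.
  escape⇒P5 : z ∈ Within 3 → S w → adj G z w ≡ true → w ∉ Within 3 → InducedSubgraph P5 G
  escape⇒P5 {z} {w} z∈W₃ sw z~w w∉W₃
    with z∉W₂                ← outside-neighbour z~w sw w∉W₃
    with sz , y , y∈W₂ , y~z ← last-step z∈W₃ z∉W₂
    with y∉W₁                ← outside-neighbour y~z sz z∉W₂
    with sy , a , a∈W₁ , a~y ← last-step y∈W₂ y∉W₁
    with _  , _ , refl , x~a ← last-step a∈W₁ (outside-neighbour a~y sy y∉W₁)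
    = path-induced G x a y z w x~a a~y y~z z~w
      (outside-nonadjacent refl sy y∉W₁)
      (outside-nonadjacent refl sz (z∉W₂ ∘ inj₁))
      (outside-nonadjacent refl sw (w∉W₃ ∘ inj₁ ∘ inj₁))
      (outside-nonadjacent a∈W₁ sz z∉W₂)
      (outside-nonadjacent a∈W₁ sw (w∉W₃ ∘ inj₁))
      (outside-nonadjacent y∈W₂ sw w∉W₃)

  within₃-closed : ¬ InducedSubgraph P5 G → z ∈ Within 3 → S w → adj G z w ≡ true → w ∈ Within 3
  within₃-closed P5-free z∈W₃ sw z~w =
    decidable-stable (within? 3 _) (P5-free ∘ escape⇒P5 z∈W₃ sw z~w)

-- Bounding a colour class

degreeBound : ℕ → ℕ
degreeBound k = 3 + (k * 3 + 4 * (k * 3))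

module LargeIndependentSet
  (G : Graph n) {k : ℕ} (colouring : Colouring k G) (K-free : ¬ InducedSubgraph K14+P1 G)
  {J : Pred (Fin n) 0ℓ} (J? : Decidable J) (J-independent : Independent G J) (7≤|J| : 7 ≤ count J?)
  where

  Big : Pred (Fin n) 0ℓ
  Big y = 4 ≤ count (J? ∩? adj? G y)

  big? : Decidable Big
  big? y = 4 ≤? count (J? ∩? adj? G y)

  big⇒complete-to-J : ∀ {c u} → Big c → u ∈ J → adj G c u ≡ true
  big⇒complete-to-J {c} {u} big ju = ¬-not λ c≁u → <-irrefl refl (≤-trans big (≤-trans
    (count-mono (J? ∩? adj? G c) (J? ∩? adj? G c ∩? nonAdj? G u)
                (λ (jz , c~z) → jz , c~z , J-independent ju jz))
    (private-neighbours≤3 G K-free J? J-independent c≁u)))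

  small⇒J-non-neighbours : ∀ {y} → y ∉ Big → 4 ≤ count (J? ∩? nonAdj? G y)
  small⇒J-non-neighbours {y} ¬big = +-cancelˡ-≤ 3 4 _ (≤-trans 7≤|J| (≤-trans
    (count-cover J? (J? ∩? adj? G y) (J? ∩? nonAdj? G y) split)
    (+-monoˡ-≤ _ (s≤s⁻¹ (≰⇒> ¬big)))))
    where
    split : J ⊆ (J ∩ Adj G y) ∪ (J ∩ NonAdj G y)
    split {z} jz with adj G y z
    ... | true  = inj₁ (jz , refl)
    ... | false = inj₂ (jz , refl)

  big⇒complete-to-small : ∀ {c y} → Big c → y ∉ Big → adj G c y ≡ true
  big⇒complete-to-small {c} {y} big ¬big =
    ¬-not λ c≁y → <-irrefl refl (≤-trans (small⇒J-non-neighbours ¬big) (≤-trans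
      (count-mono (J? ∩? nonAdj? G y) (J? ∩? adj? G c ∩? nonAdj? G y)
                  (λ (jz , y≁z) → jz , big⇒complete-to-J big jz , y≁z))
      (private-neighbours≤3 G K-free J? J-independent c≁y)))

  Low : Pred (Fin n) 0ℓ
  Low = J ∪ ∁ Big

  low? : Decidable Low
  low? = J? ∪? ∁? big?

  outside-low-complete : ∀ {c y} → c ∉ Low → y ∈ Low → adj G c y ≡ true
  outside-low-complete {c} c∉Low = [ big⇒complete-to-J big , big⇒complete-to-small big ]
    where
    big : Big c
    big = decidable-stable (big? c) (c∉Low ∘ inj₂)

  J-neighbour⇒small : ∀ {x z} → x ∈ J → adj G x z ≡ true → z ∈ Low → z ∉ Big
  J-neighbour⇒small jx x~z (inj₁ jz)  = contradiction (J-independent jx jz) (not-¬ x~z)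
  J-neighbour⇒small jx x~z (inj₂ ¬big) = ¬big

  -- A low neighbour of x ∈ J is not big, so it misses one of four fixed vertices of J.
  low-degree-J : ∀ {x} → x ∈ J → count (low? ∩? adj? G x) ≤ 4 * (k * 3)
  low-degree-J {x} jx = via (count-≥⇒distinct J? (≤-trans (s≤s (s≤s (s≤s (s≤s z≤n)))) 7≤|J|))
    where
    via : Distinct 4 J → count (low? ∩? adj? G x) ≤ 4 * (k * 3)
    via (u , u-injective , u∈J) =
      ≤-trans (count-⋃ (U? {A = Fin 4}) (λ i → adj? G x ∩? nonAdj? G (u i)) (low? ∩? adj? G x)
                       (λ {i} _ → private-neighbours≤3k G K-free colouring (J-independent jx (u∈J i)))
                       misses-some)
              (≤-reflexive (cong (_* (k * 3)) (count-U {n = 4})))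
      where
      misses-some : ∀ {z} → z ∈ Low ∩ Adj G x → ∃ λ i → U i × z ∈ Adj G x ∩ NonAdj G (u i)
      misses-some {z} (low , x~z) with all? (λ i → adj? G (u i) z)
      ... | no ¬all = let i , u≁z = ¬∀⟶∃¬ 4 _ (λ i → adj? G (u i) z) ¬all in i , _ , x~z , ¬-not u≁z
      ... | yes all = contradiction
        (distinct⇒count-≥ (J? ∩? adj? G z) (u , u-injective , λ i → u∈J i , flip-adj G (all i)))
        (J-neighbour⇒small jx x~z low)

  -- For u ∈ J non-adjacent to x, a low neighbour of x lies in J, or is missed by u, or is a
  -- low neighbour of u.
  low-degree-small : ∀ {x} → x ∉ Big → count (low? ∩? adj? G x) ≤ degreeBound k
  low-degree-small {x} ¬big
    with u , ju , x≁u ← count-satisfiable (J? ∩? nonAdj? G x)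
                          (≤-trans (s≤s z≤n) (small⇒J-non-neighbours ¬big)) =
    ≤-trans (count-cover (low? ∩? adj? G x) (J? ∩? adj? G x) (missed ∪? low? ∩? adj? G u) split)
            (+-mono-≤ (s≤s⁻¹ (≰⇒> ¬big))
              (≤-trans (count-cover (missed ∪? low? ∩? adj? G u) missed (low? ∩? adj? G u) id)
                       (+-mono-≤ (private-neighbours≤3k G K-free colouring x≁u) (low-degree-J ju))))
    where
    missed : Decidable (Adj G x ∩ NonAdj G u)
    missed = adj? G x ∩? nonAdj? G u
    split : Low ∩ Adj G x ⊆ (J ∩ Adj G x) ∪ ((Adj G x ∩ NonAdj G u) ∪ (Low ∩ Adj G u))
    split {z} (low , x~z) with J? z | adj G u z
    ... | yes jz | _     = inj₁ (jz , x~z)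
    ... | no _   | true  = inj₂ (inj₂ (low , refl))
    ... | no _   | false = inj₂ (inj₁ (x~z , refl))

  low-degree : ∀ {x} → x ∈ Low → count (low? ∩? adj? G x) ≤ degreeBound k
  low-degree (inj₁ jx)  = ≤-trans (low-degree-J jx) (≤-trans (m≤n+m _ (k * 3)) (m≤n+m _ 3))
  low-degree (inj₂ ¬big) = low-degree-small ¬big

  ball-split : ¬ InducedSubgraph P5 G → ∀ {x b} → x ∈ J → b ∈ J → b ∉ Ball.Within G low? x 3 →
               AnticompleteSplit G
  ball-split P5-free {x} {b} jx jb b∉ball = record
    { A = Within 3 ; B = Low ∖ Within 3 ; C = ∁ Low
    ; A? = within? 3 ; B? = low? ∖? within? 3 ; C? = ∁? low?
    ; covers = covers
    ; disjoint = λ z∈ball (_ , z∉ball) → z∉ball z∈ball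
    ; anticomplete = λ z∈ball (lw , w∉ball) → ¬-not (w∉ball ∘ within₃-closed P5-free z∈ball lw)
    ; complete = λ c∉Low → outside-low-complete c∉Low ∘ [ within-S (inj₁ jx) , proj₁ ]
    ; a = x ; b = b
    ; a∈A = inj₁ (inj₁ (inj₁ refl)) ; b∈B = inj₁ jb , b∉ball
    }
    where
    open Ball G low? x
    covers : ∀ z → z ∈ Within 3 ∪ (Low ∖ Within 3) ∪ ∁ Low
    covers z with low? z | within? 3 z
    ... | no  z∉Low | _          = inj₂ (inj₂ z∉Low)
    ... | yes _     | yes z∈ball = inj₁ z∈ball
    ... | yes z∈Low | no z∉ball  = inj₂ (inj₁ (z∈Low , z∉ball))

  large⇒anticomplete-split : ¬ InducedSubgraph P5 G → suc (degreeBound k) ^ 3 < count J? →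
                             AnticompleteSplit G
  large⇒anticomplete-split P5-free ball<|J| =
    let x , jx = count-satisfiable J? (≤-trans (s≤s z≤n) 7≤|J|)
        open Ball G low? x
        b , jb , b∉ball = count-<⇒∖-satisfiable J? (within? 3)
                            (≤-<-trans (count-within (inj₁ jx) low-degree 3) ball<|J|)
    in ball-split P5-free jx jb b∉ball

colourClassBound : ℕ → ℕ
colourClassBound k = 6 + suc (degreeBound k) ^ 3

colour-class-bound : {G : Graph n} {k : ℕ} → VertexCritical k G → Free₂ P5 K14+P1 G →
  ((col , _) : Colouring k G) (c : Fin k) → count (λ x → col x ≟ c) ≤ colourClassBound k
colour-class-bound {G = G} {k} critical (P5-free , K-free) colouring@(col , _) c
  with count (λ x → col x ≟ c) ≤? colourClassBound k
... | yes bounded = bounded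
... | no  ≰bound  = contradiction split (critical⇒no-anticomplete-split critical)
  where
  large : colourClassBound k < count (λ x → col x ≟ c)
  large = ≰⇒> ≰bound
  open LargeIndependentSet G colouring K-free (λ x → col x ≟ c) (colour-class-independent G colouring c)
                           (≤-trans (s≤s (m≤m+n 6 _)) large)
  split : AnticompleteSplit G
  split = large⇒anticomplete-split P5-free (≤-trans (s≤s (m≤n+m _ 6)) large)

order-bound : {G : Graph n} {k : ℕ} → VertexCritical k G → Free₂ P5 K14+P1 G →
              n ≤ k * colourClassBound k
order-bound {n = zero}  _ _ = z≤n
order-bound {n = suc m} {G = G} critical@((colouring@(col , _) , _) , _) free =
  pigeonhole-≤ col (colour-class-bound {G = G} critical free colouring)

-- Graphs of bounded order, up to isomorphism

bools : List Bool
bools = true ∷ false ∷ []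

∈-bools : ∀ b → b ∈ᴸ bools
∈-bools true  = here refl
∈-bools false = there (here refl)

vectors : List X → (n : ℕ) → List (Vec X n)
vectors xs zero    = [] ∷ []
vectors xs (suc n) = cartesianProductWith _∷_ xs (vectors xs n)

∈-vectors : {xs : List X} → (∀ x → x ∈ᴸ xs) → (v : Vec X n) → v ∈ᴸ vectors xs n
∈-vectors ∈xs []       = here refl
∈-vectors ∈xs (x ∷ v)  = ∈-cartesianProductWith⁺ _∷_ (∈xs x) (∈-vectors ∈xs v)

≟-sym-does : (i j : Fin n) → does (i ≟ j) ≡ does (j ≟ i)
≟-sym-does i j with i ≟ j | j ≟ i
... | yes _   | yes _   = refl
... | no  _   | no  _   = refl
... | yes i≡j | no  j≢i = contradiction (≡-sym i≡j) j≢i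
... | no  i≢j | yes j≡i = contradiction (≡-sym j≡i) i≢j

-- The symmetric, irreflexive part of a Boolean matrix, so that every matrix yields a graph.
fromMatrix : Vec (Vec Bool n) n → Graph n
fromMatrix M = record { adj = entry ; irrefl = entry-irrefl ; sym = entry-sym }
  where
  entry : Fin _ → Fin _ → Bool
  entry i j = not (does (i ≟ j)) ∧ (lookup (lookup M i) j ∧ lookup (lookup M j) i)
  entry-irrefl : ∀ i → entry i i ≡ false
  entry-irrefl i with i ≟ i
  ... | yes _   = refl
  ... | no  i≢i = contradiction refl i≢i
  entry-sym : ∀ i j → entry i j ≡ entry j i
  entry-sym i j = cong₂ (λ d e → not d ∧ e) (≟-sym-does i j) (∧-comm (lookup (lookup M i) j) _)

adjacencyMatrix : Graph n → Vec (Vec Bool n) n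
adjacencyMatrix G = tabulate λ i → tabulate (adj G i)

fromMatrix-adjacencyMatrix : (G : Graph n) →
                             ∀ i j → adj G i j ≡ adj (fromMatrix (adjacencyMatrix G)) i j
fromMatrix-adjacencyMatrix G i j
  rewrite lookup∘tabulate (λ i → tabulate (adj G i)) i | lookup∘tabulate (λ i → tabulate (adj G i)) j
        | lookup∘tabulate (adj G i) j | lookup∘tabulate (adj G j) i
  with i ≟ j
... | yes refl = irrefl G i
... | no  _    = trans (≡-sym (∧-idem (adj G i j))) (cong (adj G i j ∧_) (sym G i j))

same-adjacency⇒isomorphic : (G H : Graph n) → (∀ i j → adj G i j ≡ adj H i j) → Isomorphic G H
same-adjacency⇒isomorphic G H same = id , id , (λ _ → refl) , (λ _ → refl) , same

graphsOfOrder : (n : ℕ) → List (Graph n)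
graphsOfOrder n = map fromMatrix (vectors (vectors bools n) n)

graphsOfOrder-complete : (G : Graph n) → Any (Isomorphic G) (graphsOfOrder n)
graphsOfOrder-complete G =
  lose (∈-map⁺ fromMatrix (∈-vectors (∈-vectors ∈-bools) (adjacencyMatrix G)))
       (same-adjacency⇒isomorphic G (fromMatrix (adjacencyMatrix G)) (fromMatrix-adjacencyMatrix G))

taggedGraphsOfOrder : ℕ → List (Σ ℕ Graph)
taggedGraphsOfOrder n = map (n ,_) (graphsOfOrder n)

graphsUpTo : ℕ → List (Σ ℕ Graph)
graphsUpTo N = concatMap taggedGraphsOfOrder (upTo (suc N))

graphsUpTo-complete : {N : ℕ} → n ≤ N → (G : Graph n) →
                      Any (λ H → Isomorphic G (proj₂ H)) (graphsUpTo N)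
graphsUpTo-complete n≤N G =
  concatMap⁺ taggedGraphsOfOrder (lose (∈-upTo⁺ (s≤s n≤N)) (map⁺ (graphsOfOrder-complete G)))

-- The order bound holds for every k.
theorem2 : (k : ℕ) → 1 ≤ k →
    Σ (List (Σ ℕ Graph)) λ L →
      ∀ {n} (G : Graph n) → VertexCritical k G → Free₂ P5 K14+P1 G →
        Any (λ H → Isomorphic G (proj₂ H)) L
theorem2 k _ = graphsUpTo (k * colourClassBound k) , λ G critical free →
  graphsUpTo-complete (order-bound critical free) G
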